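{- Work in $\mathrm{FOL}(=,\in)$ without Extensionality, in the theory with axioms: (Sheffer strokes) $\forall A,B\,\exists X\,\forall y\,(y\in X\Leftrightarrow \neg(y\in A\wedge y\in B))$; (Singletons) $\forall A\,\exists X\,\forall y\,(y\in X\Leftrightarrow y=A)$; (Set unions) $\forall A\,\exists X\,\forall y\,(y\in X\Leftrightarrow \exists k\,(k\in A\wedge y\in k))$; (Unordered relative products) $\forall R,S\,\exists X\,\forall y\,(y\in X\Leftrightarrow \exists a,b,c,r,s\,(\mathrm{pair}(y,a,c)\wedge r\in R\wedge s\in S\wedge \mathrm{pair}(r,a,b)\wedge \mathrm{pair}(s,b,c)))$; (Unordered intersection relation set) $\exists X\,\forall y\,(y\in X\Leftrightarrow \exists a,b,c\,(\mathrm{pair}(y,a,b)\wedge c\in a\wedge c\in b))$. Then for every set $A$ there exists a set of all singleton subsets of $A$, i.e. $\forall A\,\exists X\,\forall y\,(y\in X\Leftrightarrow \exists a\,(a\in A\wedge \forall z\,(z\in y\Leftrightarrow z=a)))$.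
   Context: $\mathrm{pair}(x,a,b)$ abbreviates $\forall y\,(y\in x\Leftrightarrow y=a\vee y=b)$. Extensionality is not assumed. -}

module Defs where

open import Data.Product using (Σ; ∃; _×_; _,_)
open import Data.Sum using (_⊎_)
open import Relation.Nullary using (¬_)
open import Relation.Binary.PropositionalEquality using (_≡_)

LEM : Set₁
LEM = (P : Set) → P ⊎ ¬ P

_⇔_ : Set → Set → Set
P ⇔ Q = (P → Q) × (Q → P)
infix 3 _⇔_

-- A structure for FOL(=,∈): a domain D, a binary relation _∈_,
-- and equality interpreted as identity (_≡_).  No extensionality assumed.
module _ {D : Set} (_∈_ : D → D → Set) where

  pair : D → D → D → Set
  pair x a b = ∀ y → (y ∈ x) ⇔ (y ≡ a ⊎ y ≡ b)

  ShefferStrokes : Set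
  ShefferStrokes = ∀ A B → ∃ λ X → ∀ y → (y ∈ X) ⇔ (¬ ((y ∈ A) × (y ∈ B)))

  Singletons : Set
  Singletons = ∀ A → ∃ λ X → ∀ y → (y ∈ X) ⇔ (y ≡ A)

  SetUnions : Set
  SetUnions = ∀ A → ∃ λ X → ∀ y → (y ∈ X) ⇔ (∃ λ k → (k ∈ A) × (y ∈ k))

  UnorderedRelativeProducts : Set
  UnorderedRelativeProducts = ∀ R S → ∃ λ X → ∀ y →
    (y ∈ X) ⇔ (∃ λ a → ∃ λ b → ∃ λ c → ∃ λ r → ∃ λ s →
                 pair y a c × (r ∈ R) × (s ∈ S) × pair r a b × pair s b c)

  UnorderedIntersectionRelationSet : Set
  UnorderedIntersectionRelationSet = ∃ λ X → ∀ y →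
    (y ∈ X) ⇔ (∃ λ a → ∃ λ b → ∃ λ c → pair y a b × (c ∈ a) × (c ∈ b))

  SingletonSubsetSets : Set
  SingletonSubsetSets = ∀ A → ∃ λ X → ∀ y →
    (y ∈ X) ⇔ (∃ λ a → (a ∈ A) × (∀ z → (z ∈ y) ⇔ (z ≡ a)))

-- Sets of unordered pairs code symmetric relations, and the axioms close these codes under
-- complement, intersection and (symmetrised) relational product, while unions take domains.
-- Starting from "x meets y" one defines "x and y are comparable": x is disjoint from some m
-- that covers the universe together with y (for x ⊆ y take m = ∁ y). Two sets properly
-- overlap when they meet but are incomparable. A set containing c, another element z, and
-- missing some e properly overlaps {c, e}, whereas a singleton overlaps nothing properly.
-- Hence, as soon as the universe has two elements, the singletons {a} with a ∈ A are the
-- sets that meet A, are disjoint from some inhabited set, and properly overlap nothing.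
-- In a one-element universe A itself is the required set.
module Submission where

open import Defs
open import Level using (0ℓ)
open import Data.Product using (∃; ∃₂; _×_; _,_; proj₁; proj₂)
open import Data.Sum using (_⊎_; inj₁; inj₂; swap; reduce; [_,_]′)
open import Data.Empty using (⊥-elim)
open import Function using (_∘_)
open import Relation.Nullary using (¬_)
open import Relation.Binary.Core using (Rel)
open import Relation.Binary.PropositionalEquality using (_≡_; _≢_; refl; sym; trans; subst)

dne : LEM → {P : Set} → ¬ ¬ P → P
dne lem {P} ¬¬p with lem P
... | inj₁ p = p
... | inj₂ ¬p = ⊥-elim (¬¬p ¬p)

¬-¬×¬⇔⊎ : LEM → {P Q : Set} → (¬ (¬ P × ¬ Q)) ⇔ (P ⊎ Q)
¬-¬×¬⇔⊎ lem {P} {Q} = to , from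
  where
    to : ¬ (¬ P × ¬ Q) → P ⊎ Q
    to h with lem P | lem Q
    ... | inj₁ p | _ = inj₁ p
    ... | inj₂ _ | inj₁ q = inj₂ q
    ... | inj₂ ¬p | inj₂ ¬q = ⊥-elim (h (¬p , ¬q))
    from : P ⊎ Q → ¬ (¬ P × ¬ Q)
    from (inj₁ p) (¬p , _) = ¬p p
    from (inj₂ q) (_ , ¬q) = ¬q q

⇔-trans : {P Q R : Set} → P ⇔ Q → Q ⇔ R → P ⇔ R
⇔-trans (f , f⁻) (g , g⁻) = g ∘ f , f⁻ ∘ g⁻

⇔-sym : {P Q : Set} → P ⇔ Q → Q ⇔ P
⇔-sym (f , f⁻) = f⁻ , f

⇔-¬ : {P Q : Set} → P ⇔ Q → (¬ P) ⇔ (¬ Q)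
⇔-¬ (f , f⁻) = (λ ¬p → ¬p ∘ f⁻) , (λ ¬q → ¬q ∘ f)

⇔-× : {P Q P′ Q′ : Set} → P ⇔ P′ → Q ⇔ Q′ → (P × Q) ⇔ (P′ × Q′)
⇔-× (f , f⁻) (g , g⁻) = (λ (p , q) → f p , g q) , (λ (p , q) → f⁻ p , g⁻ q)

module _ {D : Set} {_∈_ : D → D → Set} where

  private
    Pair : D → D → D → Set
    Pair = pair _∈_

    _∉_ : D → D → Set
    z ∉ x = ¬ (z ∈ x)

  pair-elim : ∀ {p a b z} → Pair p a b → z ∈ p → z ≡ a ⊎ z ≡ b
  pair-elim h = proj₁ (h _)

  pair-introˡ : ∀ {p a b} → Pair p a b → a ∈ p
  pair-introˡ h = proj₂ (h _) (inj₁ refl)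

  pair-introʳ : ∀ {p a b} → Pair p a b → b ∈ p
  pair-introʳ h = proj₂ (h _) (inj₂ refl)

  pair-sym : ∀ {p a b} → Pair p a b → Pair p b a
  pair-sym h y = swap ∘ proj₁ (h y) , proj₂ (h y) ∘ swap

  pair-unique : ∀ {p a b x y} → Pair p a b → Pair p x y → (x ≡ a × y ≡ b) ⊎ (x ≡ b × y ≡ a)
  pair-unique hab hxy with pair-elim hab (pair-introˡ hxy) | pair-elim hab (pair-introʳ hxy)
  ... | inj₁ x≡a | inj₂ y≡b = inj₁ (x≡a , y≡b)
  ... | inj₂ x≡b | inj₁ y≡a = inj₂ (x≡b , y≡a)
  ... | inj₁ refl | inj₁ refl = inj₁ (refl , [ sym , sym ]′ (pair-elim hxy (pair-introʳ hab)))
  ... | inj₂ refl | inj₂ refl = inj₁ ([ sym , sym ]′ (pair-elim hxy (pair-introˡ hab)) , refl)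

  Represents : D → Rel D 0ℓ → Set
  Represents R ρ = ∀ p x y → Pair p x y → (p ∈ R) ⇔ ρ x y

  Sound : D → Rel D 0ℓ → Set
  Sound R ρ = ∀ p x y → Pair p x y → p ∈ R → ρ x y

  Complete : D → Rel D 0ℓ → Set
  Complete R ρ = ∀ x y → ρ x y → ∃ λ p → Pair p x y × p ∈ R

  PairsOnly : D → Set
  PairsOnly R = ∀ p → p ∈ R → ∃₂ λ x y → Pair p x y

  represents⇒sound : ∀ {R ρ} → Represents R ρ → Sound R ρ
  represents⇒sound r p x y h = proj₁ (r p x y h)

  IsSingleton : D → D → Set
  IsSingleton y a = ∀ z → (z ∈ y) ⇔ (z ≡ a)

  Inhabited : D → Set
  Inhabited x = ∃ (_∈ x)

  Meets : Rel D 0ℓ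
  Meets x y = ∃ λ c → c ∈ x × c ∈ y

  Disjoint : Rel D 0ℓ
  Disjoint x y = ¬ Meets x y

  -- Pairs are unordered, so the relational product of two codes is symmetrised.
  _⨾_ : Rel D 0ℓ → Rel D 0ℓ → Rel D 0ℓ
  (ρ ⨾ σ) x z = ∃ λ b → (ρ x b × σ b z) ⊎ (ρ z b × σ b x)

  BothInhabited : Rel D 0ℓ
  BothInhabited = Meets ⨾ Meets

  Separated : Rel D 0ℓ
  Separated x y = Disjoint x y × BothInhabited x y

  Uncovered : Rel D 0ℓ
  Uncovered = Separated ⨾ Disjoint

  -- Intended readings: Cover x y means x ∪ y is everything, Comparable x y means x ⊆ y or y ⊆ x.
  Cover : Rel D 0ℓ
  Cover x y = ¬ Uncovered x y

  Comparable : Rel D 0ℓ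
  Comparable = Disjoint ⨾ Cover

  Overlap : Rel D 0ℓ
  Overlap x y = Meets x y × ¬ Comparable x y

  BothEqual : D → Rel D 0ℓ
  BothEqual a x y = x ≡ a × y ≡ a

  bothInhabited⇒inhabitedʳ : ∀ {x y} → BothInhabited x y → Inhabited y
  bothInhabited⇒inhabitedʳ (_ , inj₁ (_ , (e , _ , e∈y))) = e , e∈y
  bothInhabited⇒inhabitedʳ (_ , inj₂ ((e , e∈y , _) , _)) = e , e∈y

  covers : ∀ {m x} → (∀ z → z ∈ m ⊎ z ∈ x) → Cover m x
  covers {m} {x} total (b , inj₁ ((m⊥b , b≠∅) , b⊥x)) with bothInhabited⇒inhabitedʳ b≠∅
  ... | e , e∈b = [ (λ e∈m → m⊥b (e , e∈m , e∈b)) , (λ e∈x → b⊥x (e , e∈b , e∈x)) ]′ (total e)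
  covers {m} {x} total (b , inj₂ ((x⊥b , b≠∅) , b⊥m)) with bothInhabited⇒inhabitedʳ b≠∅
  ... | e , e∈b = [ (λ e∈m → b⊥m (e , e∈b , e∈m)) , (λ e∈x → x⊥b (e , e∈x , e∈b)) ]′ (total e)

  trivialUniverse-singletonSubsets : (∀ c d → c ≡ d) → SingletonSubsetSets _∈_
  trivialUniverse-singletonSubsets all≡ A = A , λ y → to y , from y
    where
      to : ∀ y → y ∈ A → ∃ λ a → a ∈ A × IsSingleton y a
      to y y∈A = y , y∈A , λ z → (λ _ → all≡ z y) , λ { refl → subst (y ∈_) (all≡ A y) y∈A }
      from : ∀ y → (∃ λ a → a ∈ A × IsSingleton y a) → y ∈ A
      from y (a , a∈A , _) = subst (_∈ A) (all≡ a y) a∈A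

  module Boolean (lem : LEM) (sh : ShefferStrokes _∈_) where

    infixr 30 ∁_
    infixl 25 _∩_

    ∁_ : D → D
    ∁ R = proj₁ (sh R R)

    ∈∁ : ∀ R y → (y ∈ ∁ R) ⇔ (y ∉ R)
    ∈∁ R y = (λ m r → proj₁ stroke m (r , r)) , (λ r∉ → proj₂ stroke (r∉ ∘ proj₁))
      where stroke = proj₂ (sh R R) y

    _∩_ : D → D → D
    R ∩ T = ∁ proj₁ (sh R T)

    ∈∩ : ∀ R T y → (y ∈ R ∩ T) ⇔ (y ∈ R × y ∈ T)
    ∈∩ R T y = (λ m → dne lem (proj₁ (∈∁ _ y) m ∘ proj₂ stroke))
             , (λ rt → proj₂ (∈∁ _ y) (λ s → proj₁ stroke s rt))
      where stroke = proj₂ (sh R T) y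

    ∁-represents : ∀ {R ρ} → Represents R ρ → Represents (∁ R) (λ x y → ¬ ρ x y)
    ∁-represents {R} r p x y h = ⇔-trans (∈∁ R p) (⇔-¬ (r p x y h))

    ∩-represents : ∀ {R T ρ σ} → Represents R ρ → Represents T σ →
                   Represents (R ∩ T) (λ x y → ρ x y × σ x y)
    ∩-represents {R} {T} r t p x y h = ⇔-trans (∈∩ R T p) (⇔-× (r p x y h) (t p x y h))

    ∩-pairsOnlyˡ : ∀ {R} T → PairsOnly R → PairsOnly (R ∩ T)
    ∩-pairsOnlyˡ {R} T ps p = ps p ∘ proj₁ ∘ proj₁ (∈∩ R T p)

    ∩-pairsOnlyʳ : ∀ R {T} → PairsOnly T → PairsOnly (R ∩ T)
    ∩-pairsOnlyʳ R {T} ps p = ps p ∘ proj₂ ∘ proj₁ (∈∩ R T p)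

    ⊆⇒comparable : ∀ {x y} → (∀ {z} → z ∈ x → z ∈ y) → Comparable x y
    ⊆⇒comparable {x} {y} x⊆y = ∁ y , inj₁ (x⊥∁y , covers total)
      where
        x⊥∁y : Disjoint x (∁ y)
        x⊥∁y (z , z∈x , z∈∁y) = proj₁ (∈∁ y z) z∈∁y (x⊆y z∈x)
        total : ∀ z → z ∈ ∁ y ⊎ z ∈ y
        total z = [ inj₂ , inj₁ ∘ proj₂ (∈∁ y z) ]′ (lem (z ∈ y))

  module Pairing (lem : LEM) (sh : ShefferStrokes _∈_) (sg : Singletons _∈_) where

    open Boolean lem sh public

    ｛_｝ : D → D
    ｛ u ｝ = proj₁ (sg u)

    ∈｛｝ : ∀ {u z} → (z ∈ ｛ u ｝) ⇔ (z ≡ u)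
    ∈｛｝ {u} {z} = proj₂ (sg u) z

    ｛｝-pair : ∀ u → Pair ｛ u ｝ u u
    ｛｝-pair u z = inj₁ ∘ proj₁ ∈｛｝ , proj₂ ∈｛｝ ∘ reduce

    upair : D → D → D
    upair u v = proj₁ (sh (∁ ｛ u ｝) (∁ ｛ v ｝))

    upair-pair : ∀ u v → Pair (upair u v) u v
    upair-pair u v y =
      ⇔-trans (proj₂ (sh (∁ ｛ u ｝) (∁ ｛ v ｝)) y)
        (⇔-trans (⇔-¬ (⇔-× ∈∁｛｝ ∈∁｛｝)) (¬-¬×¬⇔⊎ lem))
      where
        ∈∁｛｝ : ∀ {w} → (y ∈ ∁ ｛ w ｝) ⇔ (y ≢ w)
        ∈∁｛｝ {w} = ⇔-trans (∈∁ ｛ w ｝ y) (⇔-¬ ∈｛｝)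

    represents⇒complete : ∀ {R ρ} → Represents R ρ → Complete R ρ
    represents⇒complete r x y q = upair x y , upair-pair x y , proj₂ (r _ x y (upair-pair x y)) q

    -- Without extensionality a pair of a with a need not be ｛ a ｝, so ｛ ｛ a ｝ ｝ does not
    -- represent BothEqual a; it is only sound and complete for it.
    ｛｛｝｝-sound : ∀ a → Sound ｛ ｛ a ｝ ｝ (BothEqual a)
    ｛｛｝｝-sound a p x y h p∈ with proj₁ ∈｛｝ p∈
    ... | refl = proj₁ ∈｛｝ (pair-introˡ h) , proj₁ ∈｛｝ (pair-introʳ h)

    ｛｛｝｝-complete : ∀ a → Complete ｛ ｛ a ｝ ｝ (BothEqual a)
    ｛｛｝｝-complete a x y (refl , refl) = ｛ a ｝ , ｛｝-pair a , proj₂ ∈｛｝ refl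

    bothInhabited : ∀ {c d x y} → c ∈ x → d ∈ y → BothInhabited x y
    bothInhabited {c} {d} c∈x d∈y =
      upair c d , inj₁ ((c , c∈x , pair-introˡ cd) , (d , pair-introʳ cd , d∈y))
      where cd = upair-pair c d

    uncovered : ∀ {m x z} → Inhabited x → z ∉ x → z ∉ m → Uncovered m x
    uncovered {m} {x} {z} (c , c∈x) z∉x z∉m =
      ｛ z ｝ , inj₂ ((x⊥｛z｝ , bothInhabited c∈x (proj₂ ∈｛｝ refl)) , ｛z｝⊥m)
      where
        x⊥｛z｝ : Disjoint x ｛ z ｝
        x⊥｛z｝ (w , w∈x , w∈｛z｝) with proj₁ ∈｛｝ w∈｛z｝
        ... | refl = z∉x w∈x
        ｛z｝⊥m : Disjoint ｛ z ｝ m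
        ｛z｝⊥m (w , w∈｛z｝ , w∈m) with proj₁ ∈｛｝ w∈｛z｝
        ... | refl = z∉m w∈m

    incomparable : ∀ {x y z e} → z ∈ x → z ∉ y → e ∈ y → e ∉ x → ¬ Comparable x y
    incomparable z∈x z∉y e∈y e∉x (m , inj₁ (x⊥m , cover)) =
      cover (uncovered (_ , e∈y) z∉y (λ z∈m → x⊥m (_ , z∈x , z∈m)))
    incomparable z∈x z∉y e∈y e∉x (m , inj₂ (y⊥m , cover)) =
      cover (uncovered (_ , z∈x) e∉x (λ e∈m → y⊥m (_ , e∈y , e∈m)))

    singleton-overlapsNothing : ∀ {y a b} → IsSingleton y a → ¬ Overlap y b
    singleton-overlapsNothing {y} {a} {b} single ((c , c∈y , c∈b) , incomparable-yb) =
      incomparable-yb (⊆⇒comparable y⊆b)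
      where
        y⊆b : ∀ {z} → z ∈ y → z ∈ b
        y⊆b {z} z∈y = subst (_∈ b) (trans (proj₁ (single c) c∈y) (sym (proj₁ (single z) z∈y))) c∈b

    -- If z ≠ c were a second element, y would properly overlap {c, e} for any e ∉ y.
    overlapsNothing-subsingleton : ∀ {y c b} → c ∈ y → Separated y b →
                                   ¬ ∃ (Overlap y) → ∀ {z} → z ∈ y → z ≡ c
    overlapsNothing-subsingleton {y} {c} c∈y (y⊥b , b≠∅) overlapsNothing {z} z∈y
      with bothInhabited⇒inhabitedʳ b≠∅
    ... | e , e∈b = dne lem λ z≢c → overlapsNothing (upair c e ,
            (c , c∈y , pair-introˡ ce) , incomparable z∈y (z∉ce z≢c) (pair-introʳ ce) e∉y)
      where
        ce = upair-pair c e
        e∉y : e ∉ y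
        e∉y e∈y = y⊥b (e , e∈y , e∈b)
        z∉ce : z ≢ c → z ∉ upair c e
        z∉ce z≢c = [ z≢c , (λ { refl → e∉y z∈y }) ]′ ∘ pair-elim ce

    singleton-separated : ∀ {y a d} → IsSingleton y a → d ≢ a → Separated y ｛ d ｝
    singleton-separated {y} {a} {d} single d≢a =
      (λ (w , w∈y , w∈｛d｝) → d≢a (trans (sym (proj₁ ∈｛｝ w∈｛d｝)) (proj₁ (single w) w∈y)))
      , bothInhabited (proj₂ (single a) refl) (proj₂ ∈｛｝ refl)

    singletonOfElement⇔ : (∃₂ λ c d → c ≢ d) → ∀ A y →
      (∃ λ a → a ∈ A × IsSingleton y a) ⇔ ((Meets y A × ∃ (Separated y)) × ¬ ∃ (Overlap y))
    singletonOfElement⇔ (c , d , c≢d) A y = to , from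
      where
        other : ∀ a → ∃ λ w → w ≢ a
        other a = [ (λ { refl → d , c≢d ∘ sym }) , (λ c≢a → c , c≢a) ]′ (lem (c ≡ a))
        to : (∃ λ a → a ∈ A × IsSingleton y a) → (Meets y A × ∃ (Separated y)) × ¬ ∃ (Overlap y)
        to (a , a∈A , single) =
          ( (a , proj₂ (single a) refl , a∈A)
          , (｛ proj₁ (other a) ｝ , singleton-separated single (proj₂ (other a))))
          , λ (b , y-overlaps-b) → singleton-overlapsNothing single y-overlaps-b
        from : (Meets y A × ∃ (Separated y)) × ¬ ∃ (Overlap y) → ∃ λ a → a ∈ A × IsSingleton y a
        from (((a , a∈y , a∈A) , (b , separated)) , overlapsNothing) =
          a , a∈A , λ z → overlapsNothing-subsingleton a∈y separated overlapsNothing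
                        , λ { refl → a∈y }

  module Construction (lem : LEM) (sh : ShefferStrokes _∈_) (sg : Singletons _∈_)
    (un : SetUnions _∈_) (rp : UnorderedRelativeProducts _∈_)
    (ir : UnorderedIntersectionRelationSet _∈_) where

    open Pairing lem sh sg

    meets : D
    meets = proj₁ ir

    meets-represents : Represents meets Meets
    meets-represents p x y h = to , from
      where
        to : p ∈ meets → Meets x y
        to m with proj₁ (proj₂ ir p) m
        ... | a , b , c , hab , c∈a , c∈b with pair-unique hab h
        ... | inj₁ (refl , refl) = c , c∈a , c∈b
        ... | inj₂ (refl , refl) = c , c∈b , c∈a
        from : Meets x y → p ∈ meets
        from (c , c∈x , c∈y) = proj₂ (proj₂ ir p) (x , y , c , h , c∈x , c∈y)

    meets-pairsOnly : PairsOnly meets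
    meets-pairsOnly p m with proj₁ (proj₂ ir p) m
    ... | a , b , _ , hab , _ = a , b , hab

    infixr 30 ⋃_
    infixl 25 _⊙_

    _⊙_ : D → D → D
    R ⊙ T = proj₁ (rp R T)

    ⊙-represents : ∀ {R T ρ σ} → Sound R ρ → Complete R ρ → Sound T σ → Complete T σ →
                   Represents (R ⊙ T) (ρ ⨾ σ)
    ⊙-represents {R} {T} {ρ} {σ} soundR completeR soundT completeT p x z h = to , from
      where
        to : p ∈ R ⊙ T → (ρ ⨾ σ) x z
        to m with proj₁ (proj₂ (rp R T) p) m
        ... | a , b , c , r , s , hac , r∈R , s∈T , hab , hbc with pair-unique hac h
        ... | inj₁ (refl , refl) = b , inj₁ (soundR r a b hab r∈R , soundT s b c hbc s∈T)
        ... | inj₂ (refl , refl) = b , inj₂ (soundR r a b hab r∈R , soundT s b c hbc s∈T)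
        from : (ρ ⨾ σ) x z → p ∈ R ⊙ T
        from (b , inj₁ (ρxb , σbz)) with completeR x b ρxb | completeT b z σbz
        ... | r , hxb , r∈R | s , hbz , s∈T =
          proj₂ (proj₂ (rp R T) p) (x , b , z , r , s , h , r∈R , s∈T , hxb , hbz)
        from (b , inj₂ (ρzb , σbx)) with completeR z b ρzb | completeT b x σbx
        ... | r , hzb , r∈R | s , hbx , s∈T =
          proj₂ (proj₂ (rp R T) p) (z , b , x , r , s , pair-sym h , r∈R , s∈T , hzb , hbx)

    ⊙-pairsOnly : ∀ R T → PairsOnly (R ⊙ T)
    ⊙-pairsOnly R T p m with proj₁ (proj₂ (rp R T) p) m
    ... | a , _ , c , _ , _ , hac , _ = a , c , hac

    ⋃_ : D → D
    ⋃ R = proj₁ (un R)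

    ⋃-domain : ∀ {R ρ} → Sound R ρ → Complete R ρ → PairsOnly R → ∀ x → (x ∈ ⋃ R) ⇔ ∃ (ρ x)
    ⋃-domain {R} {ρ} sound complete pairsOnly x = to , from
      where
        to : x ∈ ⋃ R → ∃ (ρ x)
        to m with proj₁ (proj₂ (un R) x) m
        ... | k , k∈R , x∈k with pairsOnly k k∈R
        ... | a , b , hab with pair-elim hab x∈k
        ... | inj₁ refl = b , sound k x b hab k∈R
        ... | inj₂ refl = a , sound k x a (pair-sym hab) k∈R
        from : ∃ (ρ x) → x ∈ ⋃ R
        from (y , ρxy) with complete x y ρxy
        ... | p , hxy , p∈R = proj₂ (proj₂ (un R) x) (p , p∈R , pair-introˡ hxy)

    ⊙-represents′ : ∀ {R T ρ σ} → Represents R ρ → Represents T σ → Represents (R ⊙ T) (ρ ⨾ σ)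
    ⊙-represents′ r t = ⊙-represents (represents⇒sound r) (represents⇒complete r)
                                     (represents⇒sound t) (represents⇒complete t)

    ⋃-domain′ : ∀ {R ρ} → Represents R ρ → PairsOnly R → ∀ x → (x ∈ ⋃ R) ⇔ ∃ (ρ x)
    ⋃-domain′ r = ⋃-domain (represents⇒sound r) (represents⇒complete r)

    meeting : D → D
    meeting A = ⋃ (meets ⊙ ｛ ｛ A ｝ ｝)

    ∈meeting : ∀ A x → (x ∈ meeting A) ⇔ Meets x A
    ∈meeting A x = ⇔-trans (⋃-domain′ r (⊙-pairsOnly meets ｛ ｛ A ｝ ｝) x) (to , from)
      where
        r = ⊙-represents (represents⇒sound meets-represents) (represents⇒complete meets-represents)
                         (｛｛｝｝-sound A) (｛｛｝｝-complete A)
        to : ∃ ((Meets ⨾ BothEqual A) x) → Meets x A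
        to (_ , _ , inj₁ (x-meets-b , refl , _)) = x-meets-b
        to (_ , _ , inj₂ ((c , _ , c∈A) , refl , refl)) = c , c∈A , c∈A
        from : Meets x A → ∃ ((Meets ⨾ BothEqual A) x)
        from x-meets-A = A , A , inj₁ (x-meets-A , refl , refl)

    disjoint separated comparable overlapping : D
    disjoint = ∁ meets
    separated = disjoint ∩ (meets ⊙ meets)
    comparable = disjoint ⊙ ∁ (separated ⊙ disjoint)
    overlapping = meets ∩ ∁ comparable

    disjoint-represents : Represents disjoint Disjoint
    disjoint-represents = ∁-represents meets-represents

    separated-represents : Represents separated Separated
    separated-represents = ∩-represents disjoint-represents (⊙-represents′ meets-represents meets-represents)

    comparable-represents : Represents comparable Comparable
    comparable-represents = ⊙-represents′ disjoint-represents
      (∁-represents (⊙-represents′ separated-represents disjoint-represents))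

    overlapping-represents : Represents overlapping Overlap
    overlapping-represents = ∩-represents meets-represents (∁-represents comparable-represents)

    ∈⋃separated : ∀ y → (y ∈ ⋃ separated) ⇔ ∃ (Separated y)
    ∈⋃separated = ⋃-domain′ separated-represents (∩-pairsOnlyʳ disjoint (⊙-pairsOnly meets meets))

    ∈⋃overlapping : ∀ y → (y ∈ ⋃ overlapping) ⇔ ∃ (Overlap y)
    ∈⋃overlapping = ⋃-domain′ overlapping-represents (∩-pairsOnlyˡ (∁ comparable) meets-pairsOnly)

    singletonSubsets : (∃₂ λ c d → c ≢ d) → SingletonSubsetSets _∈_
    singletonSubsets two A = X , λ y → ⇔-trans (∈X y) (⇔-sym (singletonOfElement⇔ two A y))
      where
        X = (meeting A ∩ ⋃ separated) ∩ ∁ ⋃ overlapping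
        ∈X : ∀ y → (y ∈ X) ⇔ ((Meets y A × ∃ (Separated y)) × ¬ ∃ (Overlap y))
        ∈X y = ⇔-trans (∈∩ _ _ y)
                 (⇔-× (⇔-trans (∈∩ _ _ y) (⇔-× (∈meeting A y) (∈⋃separated y)))
                      (⇔-trans (∈∁ _ y) (⇔-¬ (∈⋃overlapping y))))

mainTheorem2 : (D : Set) (_∈_ : D → D → Set) → LEM →
    ShefferStrokes _∈_ → Singletons _∈_ → SetUnions _∈_ →
    UnorderedRelativeProducts _∈_ → UnorderedIntersectionRelationSet _∈_ →
    SingletonSubsetSets _∈_
mainTheorem2 D _∈_ lem sh sg un rp ir with lem (∃₂ λ (c d : D) → c ≢ d)
... | inj₁ two = Construction.singletonSubsets {_∈_ = _∈_} lem sh sg un rp ir two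
... | inj₂ one = trivialUniverse-singletonSubsets (λ c d → dne lem (λ c≢d → one (c , d , c≢d)))
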